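{- Let $G$ be a finite non-cyclic nilpotent group with $|G|=p^mq^n$, where $p,q$ are distinct primes and $m,n\ge 1$, and let $e$ be its identity. Let $u,v\in G\setminus\{e\}$ with $\langle u\rangle\cap\langle v\rangle=\{e\}$, satisfying one of the following: (i) both $u$ and $v$ have order a positive power of $p$; (ii) both $u$ and $v$ have order a positive power of $q$; (iii) both $o(u)$ and $o(v)$ are divisible by both $p$ and $q$. Let $\mathcal{O}$ be an orientation of $Pow(G)$ such that the resulting directed graph has diameter $3$. If the edge $\{u,e\}$ is directed as $(u,e)$ in $\mathcal{O}$, then $\{v,e\}$ is directed as $(v,e)$; and if $\{u,e\}$ is directed as $(e,u)$, then $\{v,e\}$ is directed as $(e,v)$.
   Context: For a finite group $G$, the power graph $Pow(G)$ is the simple undirected graph with vertex set $G$ in which two distinct elements $x,y$ are adjacent if and only if one of them is an integer power of the other (in particular $e$ is adjacent to every other element). A finite group is nilpotent if it is the direct product of its Sylow subgroups. $o(x)$ denotes the order of $x$. An orientation assigns exactly one direction to each edge; the diameter of a directed graph is the maximum over ordered pairs $(x,y)$ of the length of a shortest directed path from $x$ to $y$. -}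

module Defs where

open import Data.Nat using (ℕ; zero; suc; _≤_)
open import Data.Integer using (ℤ; +_; -[1+_])
open import Data.Fin using (Fin)
open import Data.Fin.Subset using (Subset; _∈_; ∣_∣)
open import Data.Product using (Σ; ∃; ∃-syntax; _×_; _,_)
open import Data.Sum using (_⊎_)
open import Relation.Nullary using (¬_)
open import Relation.Binary.PropositionalEquality using (_≡_; _≢_)
open import Algebra.Structures using (IsGroup)

record FinGroup (N : ℕ) : Set where
  infixl 7 _∙_
  field
    _∙_ : Fin N → Fin N → Fin N
    ε   : Fin N
    _⁻¹ : Fin N → Fin N
    isGroup : IsGroup _≡_ _∙_ ε _⁻¹

module _ {N : ℕ} (G : FinGroup N) where
  open FinGroup G

  pow : Fin N → ℕ → Fin N
  pow x zero    = ε
  pow x (suc k) = x ∙ pow x k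

  zpow : Fin N → ℤ → Fin N
  zpow x (+ k)      = pow x k
  zpow x -[1+ k ]   = pow (x ⁻¹) (suc k)

  InCyclic : Fin N → Fin N → Set
  InCyclic x y = ∃[ i ] y ≡ zpow x i

  HasOrder : Fin N → ℕ → Set
  HasOrder x k = 1 ≤ k × pow x k ≡ ε × (∀ j → 1 ≤ j → j Data.Nat.< k → pow x j ≢ ε)

  IsCyclic : Set
  IsCyclic = ∃[ g ] ∀ x → InCyclic g x

  TrivialIntersection : Fin N → Fin N → Set
  TrivialIntersection u v = ∀ x → InCyclic u x → InCyclic v x → x ≡ ε

  IsSubgroup : Subset N → Set
  IsSubgroup H = ε ∈ H × (∀ x y → x ∈ H → y ∈ H → (x ∙ y) ∈ H) × (∀ x → x ∈ H → (x ⁻¹) ∈ H)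

  -- H is a Sylow r-subgroup, where |G| = r^k · (coprime part)
  IsSylow : (r k : ℕ) → Subset N → Set
  IsSylow r k H = IsSubgroup H × ∣ H ∣ ≡ r Data.Nat.^ k

  InternalDirectProduct : Subset N → Subset N → Set
  InternalDirectProduct P Q =
    (∀ a b → a ∈ P → b ∈ Q → a ∙ b ≡ b ∙ a) ×
    (∀ x → x ∈ P → x ∈ Q → x ≡ ε) ×
    (∀ g → ∃[ a ] ∃[ b ] (a ∈ P × b ∈ Q × g ≡ a ∙ b))

  -- For |G| = p^m q^n: G is nilpotent, i.e. the direct product of its Sylow subgroups
  IsNilpotent₂ : (p m q n : ℕ) → Set
  IsNilpotent₂ p m q n = ∃[ P ] ∃[ Q ] (IsSylow p m P × IsSylow q n Q × InternalDirectProduct P Q)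

  PowAdj : Fin N → Fin N → Set
  PowAdj x y = x ≢ y × (InCyclic x y ⊎ InCyclic y x)

  -- an orientation of Pow(G): a relation O, O x y meaning the edge is directed (x , y)
  IsOrientation : (Fin N → Fin N → Set) → Set
  IsOrientation O =
    (∀ x y → O x y → PowAdj x y) ×
    (∀ x y → PowAdj x y → O x y ⊎ O y x) ×
    (∀ x y → O x y → ¬ O y x)

data Walk {A : Set} (O : A → A → Set) : ℕ → A → A → Set where
  nil  : ∀ {x} → Walk O 0 x x
  cons : ∀ {k x y z} → O x y → Walk O k y z → Walk O (suc k) x z

HasDiameter : {A : Set} → (A → A → Set) → ℕ → Set
HasDiameter {A} O d =
  (∀ x y → ∃[ j ] (j ≤ d × Walk O j x y)) ×
  (∃[ x ] ∃[ y ] (∀ j → Walk O j x y → d ≤ j))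

{-# OPTIONS --safe #-}
-- Call s apart from t when no nontrivial power of s lies in a cyclic subgroup containing t.
-- Under each of (i)-(iii), every nontrivial x ∈ ⟨u⟩ shares a prime r with v: both ⟨x⟩ and ⟨v⟩
-- contain elements of order r (in case (iii) because o(x) divides |G| = p^m q^n). A cyclic group
-- has only one subgroup of order r, so a cyclic group containing x and v would contain a nontrivial
-- element of ⟨u⟩ ∩ ⟨v⟩. Hence u and v are apart from each other, and every path u - a - b - v in
-- Pow(G) has a = e or b = e. If {u, e} and {v, e} were oriented oppositely, say u → e → v, a directed
-- path from v to u of length at most 3 could use neither v → e nor e → u: the diameter would exceed 3.
module Submission where

open import Defs
open import Algebra.Bundles using (Group)
open import Algebra.Structures using (IsGroup)
open import Data.Empty using (⊥; ⊥-elim)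
open import Data.Fin using (Fin; toℕ; fromℕ<)
open import Data.Fin.Properties using (pigeonhole; toℕ<n; toℕ-injective; toℕ-fromℕ<) renaming (_≟_ to _≟ᶠ_)
open import Data.Integer using (+_; -[1+_])
open import Data.List using (List; []; _∷_; _++_; length; tabulate; filter; allFin)
open import Data.List.Membership.Propositional using (_∈_; _∉_)
open import Data.List.Membership.Propositional.Properties
  using (∈-tabulate⁺; ∈-tabulate⁻; ∈-filter⁺; ∈-filter⁻; ∈-++⁺ˡ; ∈-++⁺ʳ; ∈-++⁻; ∈-allFin)
open import Data.List.Membership.Propositional.Properties.WithK using (unique∧set⇒bag)
open import Data.List.Properties using (length-++; length-tabulate)
open import Data.List.Relation.Binary.BagAndSetEquality using (_∼[_]_; bag; ∼bag⇒↭)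
open import Data.List.Relation.Binary.Permutation.Propositional.Properties using (↭-length)
open import Data.List.Relation.Unary.Any using (here)
open import Data.List.Relation.Unary.Unique.Propositional using (Unique)
import Data.List.Relation.Unary.Unique.Propositional.Properties as Unique
open import Data.Nat
  using ( ℕ; zero; suc; pred; _+_; _*_; _^_; _∸_; _≤_; _<_; _%_; _/_; z≤n; s≤s; s≤s⁻¹
        ; NonZero; >-nonZero; nonTrivial⇒n>1)
open import Data.Nat.Coprimality using (Coprime; coprime-Bézout; coprime-divisor)
open import Data.Nat.DivMod using (m≡m%n+[m/n]*n; m%n<n)
open import Data.Nat.Divisibility
  using (_∣_; divides; _∣?_; ∣-refl; _∣0; n∣m*n; ∣m∣n⇒∣m+n; m%n≡0⇒n∣m; *-cancelʳ-∣)
open import Data.Nat.GCD using (module Bézout)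
open import Data.Nat.Induction using (<-rec)
open import Data.Nat.Primality using (Prime; prime⇒irreducible; prime⇒nonZero; prime⇒nonTrivial)
open import Data.Nat.Properties
open import Data.Product using (_×_; ∃-syntax; _,_; proj₁; proj₂)
open import Data.Sum as Sum using (_⊎_; inj₁; inj₂; [_,_]′)
open import Level using (0ℓ)
open import Function using (id; _∘_; case_returning_of_; mk⇔)
open import Relation.Binary.Definitions using (tri<; tri≈; tri>)
open import Relation.Binary.PropositionalEquality
  using (_≡_; _≢_; refl; sym; trans; cong; subst; module ≡-Reasoning)
open import Relation.Nullary using (¬_; yes; no; ¬?; contradiction; _×-dec_)
open import Relation.Unary using (Pred; Decidable)

least-witness : ∀ {ℓ} {P : Pred ℕ ℓ} → Decidable P → ∀ {n} → P n → ∃[ m ] (P m × (∀ {j} → j < m → ¬ P j))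
least-witness {P = P} P? = <-rec (λ n → P n → Least) search _
  where
    Least : Set _
    Least = ∃[ m ] (P m × (∀ {j} → j < m → ¬ P j))
    search : ∀ n → (∀ {j} → j < n → P j → Least) → P n → Least
    search n smaller Pn with anyUpTo? P? n
    ... | yes (j , j<n , Pj) = smaller j<n Pj
    ... | no none = n , Pn , λ j<n Pj → none (_ , j<n , Pj)

prime>1 : ∀ {r} → Prime r → 1 < r
prime>1 {r} r-prime = nonTrivial⇒n>1 r {{prime⇒nonTrivial r-prime}}

prime∤⇒coprime : ∀ {r m} → Prime r → ¬ r ∣ m → Coprime m r
prime∤⇒coprime r-prime r∤m (d∣m , d∣r) with prime⇒irreducible r-prime d∣r
... | inj₁ d≡1 = d≡1
... | inj₂ refl = contradiction d∣m r∤m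

prime-∣-divisor : ∀ {r d i} → Prime r → d ∣ r * i → ¬ d ∣ i → r ∣ d
prime-∣-divisor {r} {d} r-prime d∣ri d∤i with r ∣? d
... | yes r∣d = r∣d
... | no r∤d = contradiction (coprime-divisor (prime∤⇒coprime r-prime r∤d) d∣ri) d∤i

module FinGroupTheory {N : ℕ} (G : FinGroup N) where
  open FinGroup G
  open IsGroup isGroup using (assoc; identityˡ; identityʳ; inverseʳ)

  group : Group 0ℓ 0ℓ
  group = record { isGroup = isGroup }

  open import Algebra.Properties.Group group using (∙-cancelˡ; inverseˡ-unique; inverseʳ-unique)
  open import Algebra.Properties.Monoid.Mult (Group.monoid group)
    using () renaming (_×_ to _·_; ×-homo-+ to ·-homo-+; ×-assocˡ to ·-assocˡ)

  infixr 8 _^ᵍ_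
  _^ᵍ_ : Fin N → ℕ → Fin N
  _^ᵍ_ = pow G

  ^ᵍ≗· : ∀ x k → x ^ᵍ k ≡ k · x
  ^ᵍ≗· x zero    = refl
  ^ᵍ≗· x (suc k) = cong (x ∙_) (^ᵍ≗· x k)

  ^ᵍ-+ : ∀ x a b → x ^ᵍ (a + b) ≡ x ^ᵍ a ∙ x ^ᵍ b
  ^ᵍ-+ x a b rewrite ^ᵍ≗· x (a + b) | ^ᵍ≗· x a | ^ᵍ≗· x b = ·-homo-+ x a b

  ^ᵍ-* : ∀ x a b → x ^ᵍ (a * b) ≡ (x ^ᵍ b) ^ᵍ a
  ^ᵍ-* x a b rewrite ^ᵍ≗· x (a * b) | ^ᵍ≗· x b | ^ᵍ≗· (b · x) a = sym (·-assocˡ x a b)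

  ^ᵍ-1 : ∀ x → x ^ᵍ 1 ≡ x
  ^ᵍ-1 = identityʳ

  ε^ᵍ : ∀ a → ε ^ᵍ a ≡ ε
  ε^ᵍ zero    = refl
  ε^ᵍ (suc a) = trans (identityˡ _) (ε^ᵍ a)

  ^ᵍ-comm : ∀ x a b → (x ^ᵍ a) ^ᵍ b ≡ (x ^ᵍ b) ^ᵍ a
  ^ᵍ-comm x a b = trans (sym (^ᵍ-* x b a)) (trans (cong (x ^ᵍ_) (*-comm b a)) (^ᵍ-* x a b))

  ^ᵍ≡ε-∣ : ∀ {x d n} → x ^ᵍ d ≡ ε → d ∣ n → x ^ᵍ n ≡ ε
  ^ᵍ≡ε-∣ {x} {d} xᵈ≡ε (divides q refl) = trans (^ᵍ-* x q d) (trans (cong (_^ᵍ q) xᵈ≡ε) (ε^ᵍ q))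

  ^ᵍ-∸ : ∀ x {a b} → a ≤ b → x ^ᵍ a ≡ x ^ᵍ b → x ^ᵍ (b ∸ a) ≡ ε
  ^ᵍ-∸ x {a} {b} a≤b xᵃ≡xᵇ = sym (∙-cancelˡ (x ^ᵍ a) ε (x ^ᵍ (b ∸ a)) (begin
    x ^ᵍ a ∙ ε             ≡⟨ identityʳ _ ⟩
    x ^ᵍ a                 ≡⟨ xᵃ≡xᵇ ⟩
    x ^ᵍ b                 ≡⟨ cong (x ^ᵍ_) (m+[n∸m]≡n a≤b) ⟨
    x ^ᵍ (a + (b ∸ a))     ≡⟨ ^ᵍ-+ x a (b ∸ a) ⟩
    x ^ᵍ a ∙ x ^ᵍ (b ∸ a)  ∎))
    where open ≡-Reasoning

  ^ᵍ-mod : ∀ {x k} .{{_ : NonZero k}} → x ^ᵍ k ≡ ε → ∀ n → x ^ᵍ n ≡ x ^ᵍ (n % k)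
  ^ᵍ-mod {x} {k} xᵏ≡ε n = begin
    x ^ᵍ n                              ≡⟨ cong (x ^ᵍ_) (m≡m%n+[m/n]*n n k) ⟩
    x ^ᵍ (n % k + (n / k) * k)          ≡⟨ ^ᵍ-+ x (n % k) _ ⟩
    x ^ᵍ (n % k) ∙ x ^ᵍ ((n / k) * k)   ≡⟨ cong (x ^ᵍ (n % k) ∙_) (^ᵍ≡ε-∣ xᵏ≡ε (n∣m*n (n / k))) ⟩
    x ^ᵍ (n % k) ∙ ε                    ≡⟨ identityʳ _ ⟩
    x ^ᵍ (n % k)                        ∎
    where open ≡-Reasoning

  exponent : ∀ x → ∃[ d ] (1 ≤ d × x ^ᵍ d ≡ ε)
  exponent x with pigeonhole (n<1+n N) (λ i → x ^ᵍ toℕ i)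
  ... | i , j , i<j , xⁱ≡xʲ = toℕ j ∸ toℕ i , m<n⇒0<n∸m i<j , ^ᵍ-∸ x (<⇒≤ i<j) xⁱ≡xʲ

  order : ∀ x → ∃[ k ] HasOrder G x k
  order x with exponent x
  ... | d , exponent-d with least-witness (λ j → 1 ≤? j ×-dec x ^ᵍ j ≟ᶠ ε) exponent-d
  ...   | k , (1≤k , xᵏ≡ε) , minimal = k , 1≤k , xᵏ≡ε , λ j 1≤j j<k xʲ≡ε → minimal j<k (1≤j , xʲ≡ε)

  order-∣ : ∀ {x k n} → HasOrder G x k → x ^ᵍ n ≡ ε → k ∣ n
  order-∣ {x} {k} {n} (s≤s z≤n , xᵏ≡ε , minimal) xⁿ≡ε with n % k in n%k≡
  ... | zero  = m%n≡0⇒n∣m n k n%k≡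
  ... | suc ρ = ⊥-elim (minimal (suc ρ) (s≤s z≤n) (subst (_< k) n%k≡ (m%n<n n k)) (begin
    x ^ᵍ suc ρ    ≡⟨ cong (x ^ᵍ_) n%k≡ ⟨
    x ^ᵍ (n % k)  ≡⟨ ^ᵍ-mod xᵏ≡ε n ⟨
    x ^ᵍ n        ≡⟨ xⁿ≡ε ⟩
    ε             ∎))
    where open ≡-Reasoning

  ^ᵍ-injective : ∀ {x k i j} → HasOrder G x k → i < k → j < k → x ^ᵍ i ≡ x ^ᵍ j → i ≡ j
  ^ᵍ-injective {x} {k} {i} {j} (_ , _ , minimal) i<k j<k xⁱ≡xʲ with <-cmp i j
  ... | tri≈ _ i≡j _ = i≡j
  ... | tri< i<j _ _ = contradiction (^ᵍ-∸ x (<⇒≤ i<j) xⁱ≡xʲ)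
                         (minimal _ (m<n⇒0<n∸m i<j) (≤-<-trans (m∸n≤m j i) j<k))
  ... | tri> _ _ j<i = contradiction (^ᵍ-∸ x (<⇒≤ j<i) (sym xⁱ≡xʲ))
                         (minimal _ (m<n⇒0<n∸m j<i) (≤-<-trans (m∸n≤m i j) i<k))

  infix 4 _∈⟨_⟩
  _∈⟨_⟩ : Fin N → Fin N → Set
  y ∈⟨ x ⟩ = ∃[ i ] y ≡ x ^ᵍ i

  ∈⟨⟩-refl : ∀ x → x ∈⟨ x ⟩
  ∈⟨⟩-refl x = 1 , sym (^ᵍ-1 x)

  ∈⟨⟩-trans : ∀ {x y z} → y ∈⟨ x ⟩ → z ∈⟨ y ⟩ → z ∈⟨ x ⟩
  ∈⟨⟩-trans {x} (i , refl) (j , refl) = j * i , sym (^ᵍ-* x j i)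

  ∈⟨⟩-^ᵍ≡ε : ∀ {x y n} → y ∈⟨ x ⟩ → x ^ᵍ n ≡ ε → y ^ᵍ n ≡ ε
  ∈⟨⟩-^ᵍ≡ε {x} {n = n} (i , refl) xⁿ≡ε = trans (^ᵍ-comm x i n) (trans (cong (_^ᵍ i) xⁿ≡ε) (ε^ᵍ i))

  ⁻¹∈⟨⟩ : ∀ x → x ⁻¹ ∈⟨ x ⟩
  ⁻¹∈⟨⟩ x with exponent x
  ... | suc d , _ , xᵈ⁺¹≡ε = d , sym (inverseʳ-unique x (x ^ᵍ d) xᵈ⁺¹≡ε)

  InCyclic⇒∈⟨⟩ : ∀ {x y} → InCyclic G x y → y ∈⟨ x ⟩
  InCyclic⇒∈⟨⟩ (+ i , y≡xⁱ) = i , y≡xⁱ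
  InCyclic⇒∈⟨⟩ {x} (-[1+ i ] , y≡x⁻ⁱ⁻¹) = ∈⟨⟩-trans (⁻¹∈⟨⟩ x) (suc i , y≡x⁻ⁱ⁻¹)

  ∈⟨⟩⇒InCyclic : ∀ {x y} → y ∈⟨ x ⟩ → InCyclic G x y
  ∈⟨⟩⇒InCyclic (i , y≡xⁱ) = + i , y≡xⁱ

  prime-order-generator : ∀ {r h w} → Prime r → h ^ᵍ r ≡ ε → w ∈⟨ h ⟩ → w ≢ ε → h ∈⟨ w ⟩
  prime-order-generator {r} {h} r-prime hʳ≡ε (α , refl) hᵅ≢ε
    with coprime-Bézout (prime∤⇒coprime r-prime (hᵅ≢ε ∘ ^ᵍ≡ε-∣ hʳ≡ε))
  ... | Bézout.+- x y 1+yr≡xα = x , (begin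
    h                     ≡⟨ identityʳ h ⟨
    h ∙ ε                 ≡⟨ cong (h ∙_) (^ᵍ≡ε-∣ hʳ≡ε (n∣m*n y)) ⟨
    h ^ᵍ (1 + y * r)      ≡⟨ cong (h ^ᵍ_) 1+yr≡xα ⟩
    h ^ᵍ (x * α)          ≡⟨ ^ᵍ-* h x α ⟩
    (h ^ᵍ α) ^ᵍ x         ∎)
    where open ≡-Reasoning
  ... | Bézout.-+ x y 1+xα≡yr =
    ∈⟨⟩-trans (x , refl) (subst (_∈⟨ (h ^ᵍ α) ^ᵍ x ⟩) (sym (inverseˡ-unique _ _ h∙hᵅˣ≡ε)) (⁻¹∈⟨⟩ _))
    where
      open ≡-Reasoning
      h∙hᵅˣ≡ε : h ∙ (h ^ᵍ α) ^ᵍ x ≡ ε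
      h∙hᵅˣ≡ε = begin
        h ∙ (h ^ᵍ α) ^ᵍ x   ≡⟨ cong (h ∙_) (^ᵍ-* h x α) ⟨
        h ^ᵍ (1 + x * α)    ≡⟨ cong (h ^ᵍ_) 1+xα≡yr ⟩
        h ^ᵍ (y * r)        ≡⟨ ^ᵍ≡ε-∣ hʳ≡ε (n∣m*n y) ⟩
        ε                   ∎

  -- ⟨c⟩ has only one subgroup of order r, namely ⟨c ^ᵍ (o(c) / r)⟩.
  prime-order-unique : ∀ {r c w w′} → Prime r → w ∈⟨ c ⟩ → w′ ∈⟨ c ⟩ →
                       w ≢ ε → w ^ᵍ r ≡ ε → w′ ^ᵍ r ≡ ε → w′ ∈⟨ w ⟩
  prime-order-unique {r} {c} r-prime (i , refl) (j , refl) cⁱ≢ε cⁱʳ≡ε cʲʳ≡ε with order c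
  ... | D , c-order@(_ , cᴰ≡ε , _)
    with prime-∣-divisor r-prime (order-∣ c-order (trans (^ᵍ-* c r i) cⁱʳ≡ε)) (cⁱ≢ε ∘ ^ᵍ≡ε-∣ cᴰ≡ε)
  ...   | divides E refl =
    ∈⟨⟩-trans (prime-order-generator r-prime hʳ≡ε (∈⟨h⟩ {i} cⁱʳ≡ε) cⁱ≢ε) (∈⟨h⟩ {j} cʲʳ≡ε)
    where
      instance
        r≢0 : NonZero r
        r≢0 = prime⇒nonZero r-prime
      h : Fin N
      h = c ^ᵍ E
      hʳ≡ε : h ^ᵍ r ≡ ε
      hʳ≡ε = trans (sym (^ᵍ-* c r E)) (trans (cong (c ^ᵍ_) (*-comm r E)) cᴰ≡ε)
      ∈⟨h⟩ : ∀ {k} → (c ^ᵍ k) ^ᵍ r ≡ ε → c ^ᵍ k ∈⟨ h ⟩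
      ∈⟨h⟩ {k} cᵏʳ≡ε with *-cancelʳ-∣ {E} {k} r (subst (E * r ∣_) (*-comm r k) Er∣rk)
        where
          Er∣rk : E * r ∣ r * k
          Er∣rk = order-∣ c-order (trans (^ᵍ-* c r k) cᵏʳ≡ε)
      ... | divides α refl = α , ^ᵍ-* c α E

  module RightCosets {g : Fin N} {k : ℕ} (g-order : HasOrder G g k) where
    open import Data.List.Membership.DecPropositional (_≟ᶠ_ {N}) using (_∈?_)

    private instance
      k≢0 : NonZero k
      k≢0 = >-nonZero (proj₁ g-order)

    coset : Fin N → List (Fin N)
    coset x = tabulate {n = k} λ i → x ∙ g ^ᵍ toℕ i

    ∈-coset⁺ : ∀ x n → x ∙ g ^ᵍ n ∈ coset x
    ∈-coset⁺ x n = subst (_∈ coset x) x∙gⁿ%ᵏ≡x∙gⁿ (∈-tabulate⁺ (fromℕ< (m%n<n n k)))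
      where
        x∙gⁿ%ᵏ≡x∙gⁿ : x ∙ g ^ᵍ toℕ (fromℕ< (m%n<n n k)) ≡ x ∙ g ^ᵍ n
        x∙gⁿ%ᵏ≡x∙gⁿ = cong (x ∙_) (trans (cong (g ^ᵍ_) (toℕ-fromℕ< (m%n<n n k)))
                                         (sym (^ᵍ-mod (proj₁ (proj₂ g-order)) n)))

    ∈-coset⁻ : ∀ {x y} → y ∈ coset x → ∃[ n ] y ≡ x ∙ g ^ᵍ n
    ∈-coset⁻ y∈coset with ∈-tabulate⁻ y∈coset
    ... | i , y≡x∙gⁱ = toℕ i , y≡x∙gⁱ

    coset-unique : ∀ x → Unique (coset x)
    coset-unique x = Unique.tabulate⁺ λ {i} {j} x∙gⁱ≡x∙gʲ →
      toℕ-injective (^ᵍ-injective g-order (toℕ<n i) (toℕ<n j) (∙-cancelˡ x _ _ x∙gⁱ≡x∙gʲ))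

    ∈-coset-∙⁻ : ∀ {x y} → y ∙ g ∈ coset x → y ∈ coset x
    ∈-coset-∙⁻ {x} {y} y∙g∈coset with ∈-coset⁻ y∙g∈coset
    ... | n , y∙g≡x∙gⁿ = subst (_∈ coset x) x∙gⁿ⁺ᵏ⁻¹≡y (∈-coset⁺ x (n + pred k))
      where
        open ≡-Reasoning
        x∙gⁿ⁺ᵏ⁻¹≡y : x ∙ g ^ᵍ (n + pred k) ≡ y
        x∙gⁿ⁺ᵏ⁻¹≡y = begin
          x ∙ g ^ᵍ (n + pred k)        ≡⟨ cong (x ∙_) (^ᵍ-+ g n (pred k)) ⟩
          x ∙ (g ^ᵍ n ∙ g ^ᵍ pred k)   ≡⟨ assoc x _ _ ⟨
          (x ∙ g ^ᵍ n) ∙ g ^ᵍ pred k   ≡⟨ cong (_∙ g ^ᵍ pred k) y∙g≡x∙gⁿ ⟨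
          (y ∙ g) ∙ g ^ᵍ pred k        ≡⟨ assoc y g _ ⟩
          y ∙ g ^ᵍ suc (pred k)        ≡⟨ cong (λ m → y ∙ g ^ᵍ m) (suc-pred k) ⟩
          y ∙ g ^ᵍ k                   ≡⟨ cong (y ∙_) (proj₁ (proj₂ g-order)) ⟩
          y ∙ ε                        ≡⟨ identityʳ y ⟩
          y                            ∎

    RightClosed : List (Fin N) → Set
    RightClosed l = ∀ {y} → y ∈ l → y ∙ g ∈ l

    ∙^ᵍ-∈ : ∀ {l x} → RightClosed l → x ∈ l → ∀ n → x ∙ g ^ᵍ n ∈ l
    ∙^ᵍ-∈ {l} {x} closed x∈l zero    = subst (_∈ l) (sym (identityʳ x)) x∈l
    ∙^ᵍ-∈ {l} {x} closed x∈l (suc n) = subst (_∈ l) (assoc x g _) (∙^ᵍ-∈ closed (closed x∈l) n)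

    coset-⊆ : ∀ {l x y} → RightClosed l → x ∈ l → y ∈ coset x → y ∈ l
    coset-⊆ closed x∈l y∈coset with ∈-coset⁻ y∈coset
    ... | n , refl = ∙^ᵍ-∈ closed x∈l n

    ∉-coset? : ∀ x → Decidable (_∉ coset x)
    ∉-coset? x = ¬? ∘ (_∈? coset x)

    outside : Fin N → List (Fin N) → List (Fin N)
    outside x = filter (∉-coset? x)

    outside-closed : ∀ {l x} → RightClosed l → RightClosed (outside x l)
    outside-closed {x = x} closed y∈outside with ∈-filter⁻ (∉-coset? x) y∈outside
    ... | y∈l , y∉coset = ∈-filter⁺ (∉-coset? x) (closed y∈l) (y∉coset ∘ ∈-coset-∙⁻)

    length-split : ∀ {l x} → Unique l → RightClosed l → x ∈ l → length l ≡ k + length (outside x l)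
    length-split {l} {x} l-unique closed x∈l = begin
      length l                                  ≡⟨ ↭-length (∼bag⇒↭ l∼coset++outside) ⟩
      length (coset x ++ outside x l)           ≡⟨ length-++ (coset x) ⟩
      length (coset x) + length (outside x l)   ≡⟨ cong (_+ length (outside x l)) (length-tabulate _) ⟩
      k + length (outside x l)                  ∎
      where
        open ≡-Reasoning
        to : ∀ {y} → y ∈ l → y ∈ coset x ++ outside x l
        to {y} y∈l with y ∈? coset x
        ... | yes y∈coset = ∈-++⁺ˡ y∈coset
        ... | no  y∉coset = ∈-++⁺ʳ (coset x) (∈-filter⁺ (∉-coset? x) y∈l y∉coset)
        from : ∀ {y} → y ∈ coset x ++ outside x l → y ∈ l
        from y∈ = [ coset-⊆ closed x∈l , proj₁ ∘ ∈-filter⁻ (∉-coset? x) ]′ (∈-++⁻ (coset x) y∈)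
        l∼coset++outside : l ∼[ bag ] (coset x ++ outside x l)
        l∼coset++outside = unique∧set⇒bag l-unique
          (Unique.++⁺ (coset-unique x) (Unique.filter⁺ (∉-coset? x) l-unique)
                      (λ (y∈coset , y∈outside) → proj₂ (∈-filter⁻ (∉-coset? x) {xs = l} y∈outside) y∈coset))
          (mk⇔ to from)

    -- l is the coset of its head followed by a shorter closed list; n bounds the length.
    k∣length : ∀ n l → length l ≤ n → Unique l → RightClosed l → k ∣ length l
    k∣length _       []          _    _        _      = k ∣0
    k∣length (suc n) l@(x ∷ _) |l|≤n l-unique closed =
      subst (k ∣_) (sym split) (∣m∣n⇒∣m+n ∣-refl
        (k∣length n (outside x l) |outside|≤n (Unique.filter⁺ (∉-coset? x) l-unique) (outside-closed closed)))
      where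
        split : length l ≡ k + length (outside x l)
        split = length-split l-unique closed (here refl)
        |outside|≤n : length (outside x l) ≤ n
        |outside|≤n = s≤s⁻¹ (≤-trans (+-monoˡ-≤ _ (proj₁ g-order)) (≤-trans (≤-reflexive (sym split)) |l|≤n))

  order-∣-card : ∀ {g k} → HasOrder G g k → k ∣ N
  order-∣-card {g} g-order = subst (_ ∣_) (length-tabulate id)
    (k∣length N (allFin N) (≤-reflexive (length-tabulate id)) (Unique.allFin⁺ N) (λ {y} _ → ∈-allFin (y ∙ g)))
    where open RightCosets g-order

  ^ᵍ-card : ∀ x → x ^ᵍ N ≡ ε
  ^ᵍ-card x with order x
  ... | _ , x-order@(_ , xᵏ≡ε , _) = ^ᵍ≡ε-∣ xᵏ≡ε (order-∣-card x-order)

  -- For prime r this says that r divides o(x): ⟨x⟩ contains an element of order r.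
  infix 4 _∣ord_
  _∣ord_ : ℕ → Fin N → Set
  r ∣ord x = ∃[ w ] (w ∈⟨ x ⟩ × w ≢ ε × w ^ᵍ r ≡ ε)

  ∣ord-∈⟨⟩ : ∀ {r x y} → y ∈⟨ x ⟩ → r ∣ord y → r ∣ord x
  ∣ord-∈⟨⟩ y∈⟨x⟩ (w , w∈⟨y⟩ , w≢ε , wʳ≡ε) = w , ∈⟨⟩-trans y∈⟨x⟩ w∈⟨y⟩ , w≢ε , wʳ≡ε

  ^ᵍ-power≡ε⇒∣ord : ∀ {r x} a → x ≢ ε → x ^ᵍ (r ^ a) ≡ ε → r ∣ord x
  ^ᵍ-power≡ε⇒∣ord {r} {x} zero    x≢ε x¹≡ε = contradiction (trans (sym (^ᵍ-1 x)) x¹≡ε) x≢ε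
  ^ᵍ-power≡ε⇒∣ord {r} {x} (suc a) x≢ε xʳᵃʳ≡ε with x ^ᵍ (r ^ a) ≟ᶠ ε
  ... | yes xʳᵃ≡ε = ^ᵍ-power≡ε⇒∣ord a x≢ε xʳᵃ≡ε
  ... | no  xʳᵃ≢ε = x ^ᵍ (r ^ a) , (r ^ a , refl) , xʳᵃ≢ε , trans (sym (^ᵍ-* x r (r ^ a))) xʳᵃʳ≡ε

  ^ᵍ-two-powers≡ε⇒∣ord : ∀ {p q m n x} → x ≢ ε → x ^ᵍ (p ^ m * q ^ n) ≡ ε → p ∣ord x ⊎ q ∣ord x
  ^ᵍ-two-powers≡ε⇒∣ord {p} {q} {m} {n} {x} x≢ε xᴺ≡ε with x ^ᵍ (p ^ m) ≟ᶠ ε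
  ... | yes xᵖᵐ≡ε = inj₁ (^ᵍ-power≡ε⇒∣ord m x≢ε xᵖᵐ≡ε)
  ... | no  xᵖᵐ≢ε = inj₂ (∣ord-∈⟨⟩ {q} (p ^ m , refl) (^ᵍ-power≡ε⇒∣ord n xᵖᵐ≢ε (begin
    (x ^ᵍ (p ^ m)) ^ᵍ (q ^ n)  ≡⟨ ^ᵍ-* x (q ^ n) (p ^ m) ⟨
    x ^ᵍ (q ^ n * p ^ m)       ≡⟨ cong (x ^ᵍ_) (*-comm (q ^ n) (p ^ m)) ⟩
    x ^ᵍ (p ^ m * q ^ n)       ≡⟨ xᴺ≡ε ⟩
    ε                          ∎)))
    where open ≡-Reasoning

  order-∣⇒∣ord : ∀ {r x l} → HasOrder G x l → 1 < r → r ∣ l → r ∣ord x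
  order-∣⇒∣ord {r} {x} (1≤l , _ , _) _ (divides zero refl) = contradiction 1≤l λ ()
  order-∣⇒∣ord {r} {x} (_ , xˡ≡ε , minimal) 1<r (divides (suc e) refl) =
    x ^ᵍ suc e , (suc e , refl) , minimal (suc e) (s≤s z≤n) (m<m*n (suc e) r 1<r) ,
    trans (sym (^ᵍ-* x r (suc e))) (trans (cong (x ^ᵍ_) (*-comm r (suc e))) xˡ≡ε)

  PrimeLinked : Fin N → Fin N → Set
  PrimeLinked s t = ∀ {x} → x ∈⟨ s ⟩ → x ≢ ε → ∃[ r ] (Prime r × r ∣ord x × r ∣ord t)

  prime-power-orders-linked : ∀ {r a b u v} → Prime r → u ^ᵍ (r ^ a) ≡ ε → v ≢ ε → v ^ᵍ (r ^ b) ≡ ε →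
                              PrimeLinked u v
  prime-power-orders-linked {r} {a} {b} r-prime uʳᵃ≡ε v≢ε vʳᵇ≡ε x∈⟨u⟩ x≢ε =
    r , r-prime , ^ᵍ-power≡ε⇒∣ord {r} a x≢ε (∈⟨⟩-^ᵍ≡ε {n = r ^ a} x∈⟨u⟩ uʳᵃ≡ε) ,
    ^ᵍ-power≡ε⇒∣ord {r} b v≢ε vʳᵇ≡ε

  two-prime-orders-linked : ∀ {p q m n l u v} → Prime p → Prime q → u ^ᵍ (p ^ m * q ^ n) ≡ ε →
                            HasOrder G v l → p ∣ l → q ∣ l → PrimeLinked u v
  two-prime-orders-linked {p} {q} {m} {n} p-prime q-prime uᴺ≡ε v-order p∣l q∣l x∈⟨u⟩ x≢ε
    with ^ᵍ-two-powers≡ε⇒∣ord {p} {q} {m} {n} x≢ε (∈⟨⟩-^ᵍ≡ε {n = p ^ m * q ^ n} x∈⟨u⟩ uᴺ≡ε)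
  ... | inj₁ p∣ord-x = _ , p-prime , p∣ord-x , order-∣⇒∣ord v-order (prime>1 p-prime) p∣l
  ... | inj₂ q∣ord-x = _ , q-prime , q∣ord-x , order-∣⇒∣ord v-order (prime>1 q-prime) q∣l

  Apart : Fin N → Fin N → Set
  Apart s t = ∀ {x c} → x ∈⟨ s ⟩ → x ≢ ε → x ∈⟨ c ⟩ → t ∈⟨ c ⟩ → ⊥

  apart : ∀ {s t} → TrivialIntersection G s t → PrimeLinked s t → Apart s t
  apart s∩t linked x∈⟨s⟩ x≢ε x∈⟨c⟩ t∈⟨c⟩ with linked x∈⟨s⟩ x≢ε
  ... | r , r-prime , (w , w∈⟨x⟩ , w≢ε , wʳ≡ε) , (w′ , w′∈⟨t⟩ , w′≢ε , w′ʳ≡ε) =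
    w′≢ε (s∩t w′ (∈⟨⟩⇒InCyclic (∈⟨⟩-trans (∈⟨⟩-trans x∈⟨s⟩ w∈⟨x⟩) w′∈⟨w⟩)) (∈⟨⟩⇒InCyclic w′∈⟨t⟩))
    where
      w′∈⟨w⟩ : w′ ∈⟨ w ⟩
      w′∈⟨w⟩ = prime-order-unique r-prime (∈⟨⟩-trans x∈⟨c⟩ w∈⟨x⟩) (∈⟨⟩-trans t∈⟨c⟩ w′∈⟨t⟩) w≢ε wʳ≡ε w′ʳ≡ε

  Comparable : Fin N → Fin N → Set
  Comparable x y = y ∈⟨ x ⟩ ⊎ x ∈⟨ y ⟩

  comparable-refl : ∀ x → Comparable x x
  comparable-refl x = inj₁ (∈⟨⟩-refl x)

  no-short-path : ∀ {s a b t} → s ≢ ε → t ≢ ε → Apart s t → Apart t s →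
                  Comparable s a → Comparable a b → Comparable b t → a ≢ ε → b ≢ ε → ⊥
  no-short-path {s} {a} {b} {t} s≢ε t≢ε s∥t t∥s = paths
    where
      paths : Comparable s a → Comparable a b → Comparable b t → a ≢ ε → b ≢ ε → ⊥
      paths (inj₁ a∈⟨s⟩) (inj₁ b∈⟨a⟩) (inj₁ t∈⟨b⟩) _ _ =
        s∥t (∈⟨⟩-trans (∈⟨⟩-trans a∈⟨s⟩ b∈⟨a⟩) t∈⟨b⟩) t≢ε (∈⟨⟩-refl t) (∈⟨⟩-refl t)
      paths (inj₁ a∈⟨s⟩) (inj₁ b∈⟨a⟩) (inj₂ b∈⟨t⟩) _ b≢ε = s∥t (∈⟨⟩-trans a∈⟨s⟩ b∈⟨a⟩) b≢ε b∈⟨t⟩ (∈⟨⟩-refl t)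
      paths (inj₁ a∈⟨s⟩) (inj₂ a∈⟨b⟩) (inj₁ t∈⟨b⟩) a≢ε _ = s∥t a∈⟨s⟩ a≢ε a∈⟨b⟩ t∈⟨b⟩
      paths (inj₁ a∈⟨s⟩) (inj₂ a∈⟨b⟩) (inj₂ b∈⟨t⟩) a≢ε _ = s∥t a∈⟨s⟩ a≢ε (∈⟨⟩-trans b∈⟨t⟩ a∈⟨b⟩) (∈⟨⟩-refl t)
      paths (inj₂ s∈⟨a⟩) (inj₁ b∈⟨a⟩) (inj₁ t∈⟨b⟩) _ _ = t∥s (∈⟨⟩-refl t) t≢ε (∈⟨⟩-trans b∈⟨a⟩ t∈⟨b⟩) s∈⟨a⟩
      paths (inj₂ s∈⟨a⟩) (inj₁ b∈⟨a⟩) (inj₂ b∈⟨t⟩) _ b≢ε = t∥s b∈⟨t⟩ b≢ε b∈⟨a⟩ s∈⟨a⟩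
      paths (inj₂ s∈⟨a⟩) (inj₂ a∈⟨b⟩) (inj₁ t∈⟨b⟩) _ _ = t∥s (∈⟨⟩-refl t) t≢ε t∈⟨b⟩ (∈⟨⟩-trans a∈⟨b⟩ s∈⟨a⟩)
      paths (inj₂ s∈⟨a⟩) (inj₂ a∈⟨b⟩) (inj₂ b∈⟨t⟩) _ _ =
        s∥t (∈⟨⟩-refl s) s≢ε (∈⟨⟩-trans (∈⟨⟩-trans b∈⟨t⟩ a∈⟨b⟩) s∈⟨a⟩) (∈⟨⟩-refl t)

  module Orientation (O : Fin N → Fin N → Set) (O-orientation : IsOrientation G O) where
    private
      edges-adjacent : ∀ x y → O x y → PowAdj G x y
      edges-adjacent = proj₁ O-orientation
      adjacent-oriented : ∀ x y → PowAdj G x y → O x y ⊎ O y x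
      adjacent-oriented = proj₁ (proj₂ O-orientation)
      asymmetric : ∀ x y → O x y → ¬ O y x
      asymmetric = proj₂ (proj₂ O-orientation)

    edge-comparable : ∀ {x y} → O x y → Comparable x y
    edge-comparable o = Sum.map InCyclic⇒∈⟨⟩ InCyclic⇒∈⟨⟩ (proj₂ (edges-adjacent _ _ o))

    ε-edge : ∀ {x} → x ≢ ε → O x ε ⊎ O ε x
    ε-edge x≢ε = adjacent-oriented _ ε (x≢ε , inj₁ (+ 0 , refl))

    no-short-walk : ∀ {s t} → s ≢ ε → t ≢ ε → Apart s t → Apart t s → O ε s → O t ε →
                    ∃[ j ] (j ≤ 3 × Walk O j s t) → ⊥
    no-short-walk {s} {t} s≢ε t≢ε s∥t t∥s ε→s t→ε (_ , j≤3 , walk) = avoid j≤3 walk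
      where
        path : ∀ {a b} → Comparable s a → Comparable a b → Comparable b t → a ≢ ε → b ≢ ε → ⊥
        path = no-short-path s≢ε t≢ε s∥t t∥s
        after-s : ∀ {a} → O s a → a ≢ ε
        after-s s→a refl = asymmetric _ _ ε→s s→a
        before-t : ∀ {b} → O b t → b ≢ ε
        before-t b→t refl = asymmetric _ _ t→ε b→t
        avoid : ∀ {j} → j ≤ 3 → Walk O j s t → ⊥
        avoid _ nil = path (comparable-refl s) (comparable-refl s) (comparable-refl s) s≢ε s≢ε
        avoid _ (cons s→t nil) = path (comparable-refl s) (edge-comparable s→t) (comparable-refl t) s≢ε t≢ε
        avoid _ (cons s→a (cons a→t nil)) =
          path (edge-comparable s→a) (comparable-refl _) (edge-comparable a→t) (after-s s→a) (after-s s→a)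
        avoid _ (cons s→a (cons a→b (cons b→t nil))) =
          path (edge-comparable s→a) (edge-comparable a→b) (edge-comparable b→t) (after-s s→a) (before-t b→t)
        avoid (s≤s (s≤s (s≤s ()))) (cons _ (cons _ (cons _ (cons _ _))))

    same-orientation : (∀ x y → ∃[ j ] (j ≤ 3 × Walk O j x y)) → ∀ {u v} → u ≢ ε → v ≢ ε →
                       Apart u v → Apart v u → (O u ε → O v ε) × (O ε u → O ε v)
    same-orientation reach {u} {v} u≢ε v≢ε u∥v v∥u = to-ε , from-ε
      where
        to-ε : O u ε → O v ε
        to-ε u→ε with ε-edge v≢ε
        ... | inj₁ v→ε = v→ε
        ... | inj₂ ε→v = ⊥-elim (no-short-walk v≢ε u≢ε v∥u u∥v ε→v u→ε (reach v u))
        from-ε : O ε u → O ε v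
        from-ε ε→u with ε-edge v≢ε
        ... | inj₁ v→ε = ⊥-elim (no-short-walk u≢ε v≢ε u∥v v∥u ε→u v→ε (reach u v))
        ... | inj₂ ε→v = ε→v

mainTheorem13 : (p q m n : ℕ) → Prime p → Prime q → p ≢ q → 1 ≤ m → 1 ≤ n →
    (G : FinGroup (p ^ m * q ^ n)) →
    ¬ IsCyclic G → IsNilpotent₂ G p m q n →
    (u v : Fin (p ^ m * q ^ n)) → u ≢ FinGroup.ε G → v ≢ FinGroup.ε G →
    TrivialIntersection G u v →
    ((∃[ a ] (1 ≤ a × HasOrder G u (p ^ a)) × ∃[ b ] (1 ≤ b × HasOrder G v (p ^ b)))
      ⊎ (∃[ a ] (1 ≤ a × HasOrder G u (q ^ a)) × ∃[ b ] (1 ≤ b × HasOrder G v (q ^ b)))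
      ⊎ (∃[ k ] (HasOrder G u k × p ∣ k × q ∣ k) × ∃[ l ] (HasOrder G v l × p ∣ l × q ∣ l))) →
    (O : Fin (p ^ m * q ^ n) → Fin (p ^ m * q ^ n) → Set) →
    IsOrientation G O → HasDiameter O 3 →
    (O u (FinGroup.ε G) → O v (FinGroup.ε G)) × (O (FinGroup.ε G) u → O (FinGroup.ε G) v)
mainTheorem13 p q m n p-prime q-prime _ _ _ G _ _ u v u≢ε v≢ε u∩v orders O O-orientation (reach , _) =
  same-orientation reach u≢ε v≢ε (apart u∩v (proj₁ linked)) (apart v∩u (proj₂ linked))
  where
    open FinGroupTheory G
    open Orientation O O-orientation
    v∩u : TrivialIntersection G v u
    v∩u z z∈⟨v⟩ z∈⟨u⟩ = u∩v z z∈⟨u⟩ z∈⟨v⟩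
    linked : PrimeLinked u v × PrimeLinked v u
    linked = case orders returning (λ _ → PrimeLinked u v × PrimeLinked v u) of λ where
      (inj₁ (a , (_ , _ , uᵖᵃ≡ε , _) , b , (_ , _ , vᵖᵇ≡ε , _))) →
        prime-power-orders-linked {a = a} {b} p-prime uᵖᵃ≡ε v≢ε vᵖᵇ≡ε ,
        prime-power-orders-linked {a = b} {a} p-prime vᵖᵇ≡ε u≢ε uᵖᵃ≡ε
      (inj₂ (inj₁ (a , (_ , _ , uᵠᵃ≡ε , _) , b , (_ , _ , vᵠᵇ≡ε , _)))) →
        prime-power-orders-linked {a = a} {b} q-prime uᵠᵃ≡ε v≢ε vᵠᵇ≡ε ,
        prime-power-orders-linked {a = b} {a} q-prime vᵠᵇ≡ε u≢ε uᵠᵃ≡ε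
      (inj₂ (inj₂ (_ , (u-order , p∣k , q∣k) , _ , (v-order , p∣l , q∣l)))) →
        two-prime-orders-linked {m = m} {n} p-prime q-prime (^ᵍ-card u) v-order p∣l q∣l ,
        two-prime-orders-linked {m = m} {n} p-prime q-prime (^ᵍ-card v) u-order p∣k q∣k
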